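{- Let $n$ be a positive integer. If $\pi(2n)-\omega(2n)>\varphi(2n)/2$, then $g(n)>0$, i.e. there is a prime $p\leqslant n$ such that $2n-p$ is prime.
   Context: $\pi(x)$ is the number of primes $\leqslant x$, $\omega(m)$ is the number of distinct prime divisors of $m$, $\varphi$ is Euler's totient function, and $g(n):=|\{p\leqslant n: p \text{ prime and } 2n-p \text{ prime}\}|$. -}

module Defs where

open import Data.Nat using (ℕ; suc; _≤_)
open import Data.Nat.Divisibility using (_∣_; _∣?_)
open import Data.Nat.Primality using (Prime; prime?)
open import Data.Nat.Coprimality using (Coprime; coprime?)
open import Data.List using (List; length; filter; upTo; map)
open import Relation.Nullary.Decidable using (_×-dec_)
open import Data.Product using (_×_)

oneTo : ℕ → List ℕ
oneTo x = map suc (upTo x)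

primeCount : ℕ → ℕ
primeCount x = length (filter prime? (oneTo x))

omega : ℕ → ℕ
omega m = length (filter (λ p → prime? p ×-dec (p ∣? m)) (oneTo m))

totient : ℕ → ℕ
totient m = length (filter (λ k → coprime? k m) (oneTo m))

{-# OPTIONS --safe #-}
module Submission where

-- Write m = 2n and suppose no k ≤ m has both k and m ∸ k prime. A prime p ≤ m either
-- divides m (counted by ω) or is coprime to m (counted by φ), and gcd(m ∸ k, m) = gcd(k, m).
-- Hence for every 0 ≤ k ≤ m, the at most one prime among k and m ∸ k is paid for by
-- [k prime, k ∣ m] + [m ∸ k prime, m ∸ k ∣ m] + [gcd(k, m) = 1]. Summing over k and using
-- the symmetry k ↦ m ∸ k of the range gives 2π(m) ≤ 2ω(m) + φ(m).

open import Defs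
open import Data.Bool.Base using (true; false; if_then_else_)
open import Data.Empty using (⊥-elim)
open import Data.Fin.Base as Fin using (toℕ)
open import Data.Fin.Permutation using (reverse)
open import Data.Fin.Properties using (opposite-prop; toℕ≤pred[n])
open import Data.List.Base using (_∷_; length; filter; map; applyUpTo)
open import Data.Nat.Base using (ℕ; zero; suc; _+_; _*_; _∸_; _≤_; _<_; z≤n; s≤s)
open import Data.Nat.Coprimality using (Coprime; coprime?; 0-coprimeTo-m⇒m≡1)
open import Data.Nat.Divisibility using (_∣_; _∣?_; ∣m+n∣m⇒∣n)
open import Data.Nat.Primality using (Prime; prime?; prime⇒irreducible)
open import Data.Nat.Properties
open import Data.Product using (Σ; _×_; _,_)
open import Data.Sum using (inj₁; inj₂)
open import Data.Vec.Functional using (Vector)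
open import Function.Base using (_∘_)
open import Function.Bundles using (mk⇔)
open import Level using (Level)
open import Relation.Binary.PropositionalEquality
open import Relation.Nullary using (Dec; does; yes; no; ¬_)
open import Relation.Nullary.Decidable using (_×-dec_; toSum; dec-true; dec-false; does-⇔)
open import Relation.Unary using (Pred; Decidable)
open import Algebra.Properties.CommutativeMonoid.Sum +-0-commutativeMonoid
  using (sum; sum-syntax; sum⁺-syntax; sum-cong-≗; ∑-distrib-+; ∑-permute)

private
  variable
    a b ℓ : Level
    A B : Set a
    k m n p : ℕ

𝟙 : Dec A → ℕ
𝟙 a? = if does a? then 1 else 0

𝟙-yes : (a? : Dec A) → A → 𝟙 a? ≡ 1
𝟙-yes a? x rewrite dec-true a? x = refl

𝟙-no : (a? : Dec A) → ¬ A → 𝟙 a? ≡ 0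
𝟙-no a? ¬x rewrite dec-false a? ¬x = refl

𝟙-⇔ : (A → B) → (B → A) → (a? : Dec A) (b? : Dec B) → 𝟙 a? ≡ 𝟙 b?
𝟙-⇔ to from a? b? = cong (λ t → if t then 1 else 0) (does-⇔ (mk⇔ to from) a? b?)

∑-mono-≤ : {f g : Vector ℕ n} → (∀ i → f i ≤ g i) → sum f ≤ sum g
∑-mono-≤ {zero}  _   = z≤n
∑-mono-≤ {suc n} f≤g = +-mono-≤ (f≤g Fin.zero) (∑-mono-≤ (f≤g ∘ Fin.suc))

∑-reflect : ∀ m (f : ℕ → ℕ) → ∑[ i ≤ m ] f (m ∸ toℕ i) ≡ ∑[ i ≤ m ] f (toℕ i)
∑-reflect m f = sym (trans (∑-permute (f ∘ toℕ) reverse) (sum-cong-≗ (cong f ∘ opposite-prop)))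

map-applyUpTo : ∀ (f : A → B) g n → map f (applyUpTo g n) ≡ applyUpTo (f ∘ g) n
map-applyUpTo f g zero    = refl
map-applyUpTo f g (suc n) = cong (f (g 0) ∷_) (map-applyUpTo f (g ∘ suc) n)

module _ {P : Pred ℕ ℓ} (P? : Decidable P) where

  length-filter-applyUpTo : ∀ f n → length (filter P? (applyUpTo f n)) ≡ ∑[ i < n ] 𝟙 (P? (f (toℕ i)))
  length-filter-applyUpTo f zero = refl
  length-filter-applyUpTo f (suc n) with does (P? (f 0))
  ... | true  = cong suc (length-filter-applyUpTo (f ∘ suc) n)
  ... | false = length-filter-applyUpTo (f ∘ suc) n

  length-filter-oneTo : ∀ m → 𝟙 (P? 0) + length (filter P? (oneTo m)) ≡ ∑[ i ≤ m ] 𝟙 (P? (toℕ i))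
  length-filter-oneTo m = cong (𝟙 (P? 0) +_)
    (trans (cong (length ∘ filter P?) (map-applyUpTo suc (λ i → i) m)) (length-filter-applyUpTo suc m))

χ-prime : ℕ → ℕ
χ-prime k = 𝟙 (prime? k)

χ-primeDivisor : ℕ → ℕ → ℕ
χ-primeDivisor m k = 𝟙 (prime? k ×-dec k ∣? m)

χ-coprime : ℕ → ℕ → ℕ
χ-coprime m k = 𝟙 (coprime? k m)

primeCount≡∑ : ∀ m → primeCount m ≡ ∑[ i ≤ m ] χ-prime (toℕ i)
primeCount≡∑ = length-filter-oneTo prime?

omega≡∑ : ∀ m → omega m ≡ ∑[ i ≤ m ] χ-primeDivisor m (toℕ i)
omega≡∑ m = length-filter-oneTo (λ k → prime? k ×-dec k ∣? m) m

-- Sums start at k = 0 so that k ↦ m ∸ k permutes the range; 0 is coprime to m only for m = 1.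
totient≡∑ : m ≢ 1 → totient m ≡ ∑[ i ≤ m ] χ-coprime m (toℕ i)
totient≡∑ {m} m≢1 = begin
  totient m                  ≡⟨ cong (_+ totient m) (𝟙-no (coprime? 0 m) (m≢1 ∘ 0-coprimeTo-m⇒m≡1)) ⟨
  χ-coprime m 0 + totient m  ≡⟨ length-filter-oneTo (λ k → coprime? k m) m ⟩
  ∑[ i ≤ m ] χ-coprime m (toℕ i) ∎
  where open ≡-Reasoning

prime∤⇒coprime : Prime p → ¬ p ∣ m → Coprime p m
prime∤⇒coprime pp p∤m (d∣p , d∣m) with prime⇒irreducible pp d∣p
... | inj₁ d≡1 = d≡1
... | inj₂ refl = ⊥-elim (p∤m d∣m)

coprime-∸ : k ≤ m → Coprime k m → Coprime (m ∸ k) m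
coprime-∸ {k} k≤m coprime (d∣m∸k , d∣m) =
  coprime (∣m+n∣m⇒∣n (subst (_ ∣_) (sym (m∸n+n≡m k≤m)) d∣m) d∣m∸k , d∣m)

χ-coprime-∸ : k ≤ m → χ-coprime m (m ∸ k) ≡ χ-coprime m k
χ-coprime-∸ {k} {m} k≤m = 𝟙-⇔
  (subst (λ j → Coprime j m) (m∸[m∸n]≡n k≤m) ∘ coprime-∸ (m∸n≤m m k))
  (coprime-∸ k≤m) (coprime? (m ∸ k) m) (coprime? k m)

χ-prime≤χ-primeDivisor+χ-coprime : ∀ m k → χ-prime k ≤ χ-primeDivisor m k + χ-coprime m k
χ-prime≤χ-primeDivisor+χ-coprime m k with prime? k | k ∣? m
... | no _   | _       = z≤n
... | yes _  | yes _   = s≤s z≤n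
... | yes pk | no  k∤m = ≤-reflexive (sym (𝟙-yes (coprime? k m) (prime∤⇒coprime pk k∤m)))

NoGoldbachPairBelow : ℕ → ℕ → Set
NoGoldbachPairBelow b m = ∀ {k} → k ≤ b → Prime k → ¬ Prime (m ∸ k)

χ-prime-pair≤ : NoGoldbachPairBelow m m → k ≤ m →
  χ-prime k + χ-prime (m ∸ k) ≤ χ-primeDivisor m k + χ-primeDivisor m (m ∸ k) + χ-coprime m k
χ-prime-pair≤ {m} {k} noPair k≤m with toSum (prime? k)
... | inj₁ pk = begin
  χ-prime k + χ-prime (m ∸ k)  ≡⟨ cong (χ-prime k +_) (𝟙-no (prime? (m ∸ k)) (noPair k≤m pk)) ⟩
  χ-prime k + 0                ≡⟨ +-identityʳ (χ-prime k) ⟩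
  χ-prime k                    ≤⟨ χ-prime≤χ-primeDivisor+χ-coprime m k ⟩
  χ-primeDivisor m k + χ-coprime m k
    ≤⟨ +-monoˡ-≤ (χ-coprime m k) (m≤m+n (χ-primeDivisor m k) _) ⟩
  χ-primeDivisor m k + χ-primeDivisor m (m ∸ k) + χ-coprime m k ∎
  where open ≤-Reasoning
... | inj₂ ¬pk = begin
  χ-prime k + χ-prime (m ∸ k)  ≡⟨ cong (_+ χ-prime (m ∸ k)) (𝟙-no (prime? k) ¬pk) ⟩
  χ-prime (m ∸ k)              ≤⟨ χ-prime≤χ-primeDivisor+χ-coprime m (m ∸ k) ⟩
  χ-primeDivisor m (m ∸ k) + χ-coprime m (m ∸ k)
    ≡⟨ cong (χ-primeDivisor m (m ∸ k) +_) (χ-coprime-∸ k≤m) ⟩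
  χ-primeDivisor m (m ∸ k) + χ-coprime m k
    ≤⟨ +-monoˡ-≤ (χ-coprime m k) (m≤n+m (χ-primeDivisor m (m ∸ k)) _) ⟩
  χ-primeDivisor m k + χ-primeDivisor m (m ∸ k) + χ-coprime m k ∎
  where open ≤-Reasoning

noGoldbachPair⇒primeCount≤ : m ≢ 1 → NoGoldbachPairBelow m m →
  2 * primeCount m ≤ 2 * omega m + totient m
noGoldbachPair⇒primeCount≤ {m} m≢1 noPair = begin
  2 * primeCount m                                   ≡⟨ cong (2 *_) (primeCount≡∑ m) ⟩
  2 * ∑₀ χP                                          ≡⟨ cong (∑₀ χP +_) (+-identityʳ (∑₀ χP)) ⟩
  ∑₀ χP + ∑₀ χP                                      ≡⟨ cong (∑₀ χP +_) (∑-reflect m χP) ⟨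
  ∑₀ χP + ∑₀ (χP ∘ (m ∸_))                           ≡⟨ ∑-distrib-+ {suc m} (χP ∘ toℕ) (χP ∘ (m ∸_) ∘ toℕ) ⟨
  ∑₀ (λ k → χP k + χP (m ∸ k))                       ≤⟨ ∑-mono-≤ (χ-prime-pair≤ noPair ∘ toℕ≤pred[n]) ⟩
  ∑₀ (λ k → χB k + χB (m ∸ k) + χC k)                ≡⟨ ∑-distrib-+ {suc m} (λ i → χB (toℕ i) + χB (m ∸ toℕ i)) (χC ∘ toℕ) ⟩
  ∑₀ (λ k → χB k + χB (m ∸ k)) + ∑₀ χC               ≡⟨ cong (_+ ∑₀ χC) (∑-distrib-+ {suc m} (χB ∘ toℕ) (χB ∘ (m ∸_) ∘ toℕ)) ⟩
  ∑₀ χB + ∑₀ (χB ∘ (m ∸_)) + ∑₀ χC                   ≡⟨ cong (λ s → ∑₀ χB + s + ∑₀ χC) (∑-reflect m χB) ⟩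
  ∑₀ χB + ∑₀ χB + ∑₀ χC                              ≡⟨ cong (λ s → ∑₀ χB + s + ∑₀ χC) (+-identityʳ (∑₀ χB)) ⟨
  2 * ∑₀ χB + ∑₀ χC                                  ≡⟨ cong₂ (λ s t → 2 * s + t) (omega≡∑ m) (totient≡∑ m≢1) ⟨
  2 * omega m + totient m                            ∎
  where
  open ≤-Reasoning
  ∑₀ : (ℕ → ℕ) → ℕ
  ∑₀ f = ∑[ i ≤ m ] f (toℕ i)
  χP χB χC : ℕ → ℕ
  χP = χ-prime
  χB = χ-primeDivisor m
  χC = χ-coprime m

noGoldbachPairBelow-double : NoGoldbachPairBelow n (2 * n) → NoGoldbachPairBelow (2 * n) (2 * n)
noGoldbachPairBelow-double {n} noPair {k} k≤2n pk pk' with k ≤? n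
... | yes k≤n = noPair k≤n pk pk'
... | no  k≰n = noPair 2n∸k≤n pk' (subst Prime (sym (m∸[m∸n]≡n k≤2n)) pk)
  where
  2n∸k≤n : 2 * n ∸ k ≤ n
  2n∸k≤n = m≤n+o⇒m∸n≤o (2 * n) k
    (≤-trans (≤-reflexive (cong (n +_) (+-identityʳ n))) (+-monoˡ-≤ n (<⇒≤ (≰⇒> k≰n))))

proposition4p3 : (n : ℕ) → 1 ≤ n →
    2 * omega (2 * n) + totient (2 * n) < 2 * primeCount (2 * n) →
    Σ ℕ (λ p → Prime p × p ≤ n × Prime (2 * n ∸ p))
proposition4p3 n@(suc n-1) _ countsExceed
  with anyUpTo? (λ p → prime? p ×-dec prime? (2 * n ∸ p)) (suc n)
... | yes (p , p<1+n , pp , pq) = p , pp , ≤-pred p<1+n , pq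
... | no ¬pair = ⊥-elim (<⇒≱ countsExceed (noGoldbachPair⇒primeCount≤ 2n≢1 noPair))
  where
  2n≢1 : 2 * n ≢ 1
  2n≢1 = m+1+n≢0 n-1 ∘ suc-injective
  noPair : NoGoldbachPairBelow (2 * n) (2 * n)
  noPair = noGoldbachPairBelow-double (λ p≤n pp pq → ¬pair (_ , s≤s p≤n , pp , pq))
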